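{- Let $p$ be an odd prime. Let $A,B,C\in\mathbb{Z}$ with $\gcd(A,p)=1$, set $f(X)=AX^2+BX+C$ and $D=B^2-4AC$. Let $r\in\mathbb{Z}$ with $f(r)\equiv 0\pmod{p^2}$ (so that $\gcd(D,p)=1$ or $p^2\mid D$). For a positive integer $k$ let $R(k)$ be the statement $$(2A)r\equiv -B\pmod{p^k}\quad\text{and}\quad f(r)\equiv 0\pmod{p^{k+2}}.$$ Then (with $(2A)^{ -1}$ denoting an inverse of $2A$ modulo the relevant power of $p$): (i) If $\gcd(p,D)=1$, then $R(1)$ does not hold. (ii) If $p^2\,\|\,D$, then $R(1)$ holds if and only if $r\equiv -B(2A)^{ -1}+py\pmod{p^2}$ for some $y\in\mathbb{Z}$ with $(2Ay)^2\equiv Dp^{ -2}\pmod p$; and $R(2)$ does not hold. (iii) If $p^3\,\|\,D$, then $R(1)$ holds if and only if $r\equiv -B(2A)^{ -1}\pmod{p^2}$; and $R(2)$ does not hold. (iv) If $p^4\mid D$, then $R(1)$ holds if and only if $r\equiv -B(2A)^{ -1}\pmod{p^2}$, and $R(2)$ holds if and only if $r\equiv -B(2A)^{ -1}\pmod{p^2}$.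
   Context: $p^m\,\|\,D$ means $p^m\mid D$ and $p^{m+1}\nmid D$. -}

module Defs where

open import Data.Nat as ℕ using (ℕ)
open import Data.Integer using (ℤ; +_; _+_; _-_; _*_; -_)
open import Data.Integer.Divisibility using (_∣_)
open import Data.Product using (_×_)
open import Relation.Nullary using (¬_)

_≡_[mod_] : ℤ → ℤ → ℕ → Set
a ≡ b [mod m ] = + m ∣ (a - b)

infix 4 _≡_[mod_]

quadf : ℤ → ℤ → ℤ → ℤ → ℤ
quadf A B C x = A * x * x + B * x + C

disc : ℤ → ℤ → ℤ → ℤ
disc A B C = B * B - + 4 * A * C

R : ℕ → ℤ → ℤ → ℤ → ℤ → ℕ → Set
R p A B C r k =
  ((+ 2 * A) * r ≡ - B [mod p ℕ.^ k ]) × (quadf A B C r ≡ + 0 [mod p ℕ.^ (k ℕ.+ 2) ])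

_^_∥_ : ℕ → ℕ → ℤ → Set
p ^ m ∥ D = (+ (p ℕ.^ m) ∣ D) × ¬ (+ (p ℕ.^ (m ℕ.+ 1)) ∣ D)

infix 4 _^_∥_

{-# OPTIONS --safe #-}

-- With s = 2Ar + B one has 4A·f(r) = s² − D, and p ∤ 4A because p is odd and prime to A, so
-- p^j ∣ f(r) iff p^j ∣ s² − D.  Hence R(k) says p^k ∣ s and p^(k+2) ∣ s² − D, and everything is a
-- comparison of the powers of p dividing s² and D: R(1) forces p ∣ D and R(2) forces p⁴ ∣ D; if p³ ∣ D,
-- then p³ ∣ s² iff p² ∣ s; and if D = p²D', then R(1) holds iff s ≡ pw (mod p²) for some w with
-- w² ≡ D' (mod p).  Multiplying by u = (2A)⁻¹ mod p² turns these conditions on s into conditions on r,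
-- with w = 2Ay.

module Submission where

open import Defs
open import Data.Nat as ℕ using (ℕ)
open import Data.Nat.Primality using (Prime)
open import Data.Integer using (ℤ; +_; _+_; _-_; _*_; -_)
open import Data.Integer.Divisibility using (_∣_)
open import Data.Integer.GCD using (gcd)
open import Data.Product using (_×_; ∃-syntax)
open import Function.Bundles using (_⇔_)
open import Relation.Nullary using (¬_)
open import Relation.Binary.PropositionalEquality using (_≡_)

open import Data.Nat using (zero; suc; NonZero; nonTrivial⇒≢1; nonTrivial⇒n>1)
import Data.Nat.Properties as ℕP
import Data.Nat.Divisibility as ℕᵈ
import Data.Nat.GCD as ℕG
open import Data.Nat.Primality using (euclidsLemma; prime⇒nonZero; prime⇒nonTrivial)
open import Data.Integer using (∣_∣)
import Data.Integer.Properties as ℤP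
open import Data.Integer.GCD using (gcd-comm)
open import Data.Integer.Divisibility.Signed
  using (∣ᵤ⇒∣; ∣⇒∣ᵤ; divides; ∣-refl; ∣-trans; ∣m∣n⇒∣m+n; ∣m∣n⇒∣m-n; ∣n⇒∣m*n; ∣m⇒∣m*n)
  renaming (_∣_ to _∣ˢ_)
open import Data.Integer.Tactic.RingSolver using (solve-∀)
open import Data.Product using (_,_; proj₁; proj₂)
open import Data.Product.Function.NonDependent.Propositional using (_×-⇔_)
open import Data.Sum using (_⊎_; inj₁; inj₂; [_,_]′; map)
open import Function.Base using (id; _∘_)
open import Function.Bundles using (mk⇔; Equivalence)
open import Function.Properties.Equivalence using () renaming (trans to ⇔-trans)
open import Relation.Nullary using (contradiction)
open import Relation.Binary.PropositionalEquality
  using (_≢_; refl; sym; trans; cong; cong₂; subst; subst₂; module ≡-Reasoning)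

open Equivalence using (to; from)

∣m-n∣n⇒∣m : ∀ {i m n} → i ∣ˢ m - n → i ∣ˢ n → i ∣ˢ m
∣m-n∣n⇒∣m {i} {m} {n} i∣m-n i∣n = subst (i ∣ˢ_) (m-n+n≡m m n) (∣m∣n⇒∣m+n i∣m-n i∣n)
  where
    m-n+n≡m : ∀ m n → m - n + n ≡ m
    m-n+n≡m = solve-∀

∣m∣m-n⇒∣n : ∀ {i m n} → i ∣ˢ m → i ∣ˢ m - n → i ∣ˢ n
∣m∣m-n⇒∣n {i} {m} {n} i∣m i∣m-n = subst (i ∣ˢ_) (m-[m-n]≡n m n) (∣m∣n⇒∣m-n i∣m i∣m-n)
  where
    m-[m-n]≡n : ∀ m n → m - (m - n) ≡ n
    m-[m-n]≡n = solve-∀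

module Powers (p : ℕ) where

  p^_ : ℕ → ℤ
  p^ k = + (p ℕ.^ k)

  p^1≡p : p^ 1 ≡ + p
  p^1≡p = cong +_ (ℕP.^-identityʳ p)

  p∣a⇒p^1∣a : ∀ {a} → + p ∣ˢ a → p^ 1 ∣ˢ a
  p∣a⇒p^1∣a {a} = subst (_∣ˢ a) (sym p^1≡p)

  p^1∣a⇒p∣a : ∀ {a} → p^ 1 ∣ˢ a → + p ∣ˢ a
  p^1∣a⇒p∣a {a} = subst (_∣ˢ a) p^1≡p

  p^2≡p*p : p^ 2 ≡ + p * + p
  p^2≡p*p = trans (cong (λ e → + (p ℕ.* e)) (ℕP.*-identityʳ p)) (ℤP.pos-* p p)

  p^[m+n]∣a⇒p^m∣a : ∀ m n {a} → p^ (m ℕ.+ n) ∣ˢ a → p^ m ∣ˢ a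
  p^[m+n]∣a⇒p^m∣a m n = ∣-trans (∣ᵤ⇒∣
    (subst (p ℕ.^ m ℕᵈ.∣_) (sym (ℕP.^-distribˡ-+-* p m n)) (ℕᵈ.m∣m*n (p ℕ.^ n))))

  p^m∣a∧p^n∣b⇒p^[m+n]∣a*b : ∀ m n {a b} → p^ m ∣ˢ a → p^ n ∣ˢ b → p^ (m ℕ.+ n) ∣ˢ a * b
  p^m∣a∧p^n∣b⇒p^[m+n]∣a*b m n {a} {b} p^m∣a p^n∣b = ∣ᵤ⇒∣ (subst₂ ℕᵈ._∣_
    (sym (ℕP.^-distribˡ-+-* p m n)) (sym (ℤP.abs-* a b))
    (ℕᵈ.*-pres-∣ (∣⇒∣ᵤ p^m∣a) (∣⇒∣ᵤ p^n∣b)))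

  p²∣s-pw⇒p∣s : ∀ {s w} → p^ 2 ∣ˢ s - + p * w → + p ∣ˢ s
  p²∣s-pw⇒p∣s {s} {w} p²∣s-pw =
    ∣m-n∣n⇒∣m (p^1∣a⇒p∣a (p^[m+n]∣a⇒p^m∣a 1 1 p²∣s-pw)) (∣m⇒∣m*n w ∣-refl)

  module _ .{{_ : NonZero p}} where

    p^[m+n]∣p^m*a⇒p^n∣a : ∀ m n {a} → p^ (m ℕ.+ n) ∣ˢ p^ m * a → p^ n ∣ˢ a
    p^[m+n]∣p^m*a⇒p^n∣a m n {a} p^[m+n]∣p^m*a =
      ∣ᵤ⇒∣ (ℕᵈ.*-cancelˡ-∣ (p ℕ.^ m) {{ℕP.m^n≢0 p m}}
        (subst₂ ℕᵈ._∣_ (ℕP.^-distribˡ-+-* p m n) (ℤP.abs-* (p^ m) a) (∣⇒∣ᵤ p^[m+n]∣p^m*a)))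

    p∣s∧p³∣s²-p²d⇒∃w : ∀ {s d} → + p ∣ˢ s → p^ 3 ∣ˢ s * s - p^ 2 * d →
                        ∃[ w ] (p^ 2 ∣ˢ s - + p * w × + p ∣ˢ w * w - d)
    p∣s∧p³∣s²-p²d⇒∃w {s} {d} (divides t s≡t*p) p³∣s²-p²d = t , p²∣s-pt , p∣t²-d
      where
        open ≡-Reasoning

        s-pt≡0 : s - + p * t ≡ + 0
        s-pt≡0 = trans (cong (_- + p * t) s≡t*p) (tq-qt≡0 t (+ p))
          where
            tq-qt≡0 : ∀ t q → t * q - q * t ≡ + 0
            tq-qt≡0 = solve-∀

        p²∣s-pt : p^ 2 ∣ˢ s - + p * t
        p²∣s-pt = subst (p^ 2 ∣ˢ_) (sym s-pt≡0) (divides (+ 0) (sym (ℤP.*-zeroˡ (p^ 2))))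

        s²-p²d≡p²[t²-d] : s * s - p^ 2 * d ≡ p^ 2 * (t * t - d)
        s²-p²d≡p²[t²-d] = begin
          s * s - p^ 2 * d                        ≡⟨ cong₂ (λ x y → x * x - y * d) s≡t*p p^2≡p*p ⟩
          (t * + p) * (t * + p) - (+ p * + p) * d ≡⟨ [tq]²-q²d≡q²[t²-d] t (+ p) d ⟩
          (+ p * + p) * (t * t - d)               ≡⟨ cong (_* (t * t - d)) (sym p^2≡p*p) ⟩
          p^ 2 * (t * t - d)                      ∎
          where
            [tq]²-q²d≡q²[t²-d] : ∀ t q d → (t * q) * (t * q) - (q * q) * d ≡ (q * q) * (t * t - d)
            [tq]²-q²d≡q²[t²-d] = solve-∀

        p∣t²-d : + p ∣ˢ t * t - d
        p∣t²-d = p^1∣a⇒p∣a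
          (p^[m+n]∣p^m*a⇒p^n∣a 2 1 (subst (p^ 3 ∣ˢ_) s²-p²d≡p²[t²-d] p³∣s²-p²d))

    p²∣s-pw∧p∣w²-d⇒p³∣s²-p²d : ∀ {s d w} → p^ 2 ∣ˢ s - + p * w → + p ∣ˢ w * w - d →
                               p^ 3 ∣ˢ s * s - p^ 2 * d
    p²∣s-pw∧p∣w²-d⇒p³∣s²-p²d {s} {d} {w} p²∣s-pw p∣w²-d =
      subst (p^ 3 ∣ˢ_) (sym s²-p²d≡[s-pw][s+pw]+p²[w²-d])
        (∣m∣n⇒∣m+n (p^m∣a∧p^n∣b⇒p^[m+n]∣a*b 2 1 p²∣s-pw (p∣a⇒p^1∣a p∣s+pw))
                   (p^m∣a∧p^n∣b⇒p^[m+n]∣a*b 2 1 ∣-refl (p∣a⇒p^1∣a p∣w²-d)))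
      where
        open ≡-Reasoning

        p∣s+pw : + p ∣ˢ s + + p * w
        p∣s+pw = ∣m∣n⇒∣m+n (p²∣s-pw⇒p∣s {s} {w} p²∣s-pw) (∣m⇒∣m*n w ∣-refl)

        s²-p²d≡[s-pw][s+pw]+p²[w²-d] : s * s - p^ 2 * d ≡ (s - + p * w) * (s + + p * w) + p^ 2 * (w * w - d)
        s²-p²d≡[s-pw][s+pw]+p²[w²-d] = begin
          s * s - p^ 2 * d                   ≡⟨ cong (λ y → s * s - y * d) p^2≡p*p ⟩
          s * s - (+ p * + p) * d            ≡⟨ difference-of-squares s (+ p) w d ⟩
          [s-pw][s+pw] + (+ p * + p) * w²-d  ≡⟨ cong (λ y → [s-pw][s+pw] + y * w²-d) (sym p^2≡p*p) ⟩
          [s-pw][s+pw] + p^ 2 * w²-d         ∎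
          where
            [s-pw][s+pw] : ℤ
            [s-pw][s+pw] = (s - + p * w) * (s + + p * w)
            w²-d : ℤ
            w²-d = w * w - d
            difference-of-squares : ∀ s q w d →
              s * s - (q * q) * d ≡ (s - q * w) * (s + q * w) + (q * q) * (w * w - d)
            difference-of-squares = solve-∀

module PrimePowers {p : ℕ} (p-prime : Prime p) where

  open Powers p

  instance
    p≢0 : NonZero p
    p≢0 = prime⇒nonZero p-prime

  p^k∣q⇒p^[1+k]∣q*p : ∀ k {q} → p ℕ.^ k ℕᵈ.∣ q → p ℕ.^ suc k ℕᵈ.∣ q ℕ.* p
  p^k∣q⇒p^[1+k]∣q*p k {q} p^k∣q =
    subst (ℕᵈ._∣ q ℕ.* p) (ℕP.*-comm (p ℕ.^ k) p) (ℕᵈ.*-monoˡ-∣ p p^k∣q)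

  p^k∣m*n⇒p^k∣n : ∀ k {m n} → ¬ p ℕᵈ.∣ m → p ℕ.^ k ℕᵈ.∣ m ℕ.* n → p ℕ.^ k ℕᵈ.∣ n
  p^k∣m*n⇒p^k∣n zero    _   _ = ℕᵈ.1∣ _
  p^k∣m*n⇒p^k∣n (suc k) {m} {n} p∤m p^[1+k]∣mn
    with euclidsLemma m n p-prime (ℕᵈ.∣-trans (ℕᵈ.m∣m*n (p ℕ.^ k)) p^[1+k]∣mn)
  ... | inj₁ p∣m = contradiction p∣m p∤m
  ... | inj₂ (ℕᵈ.divides q refl) = p^k∣q⇒p^[1+k]∣q*p k {q} (p^k∣m*n⇒p^k∣n k {m} {q} p∤m p^k∣mq)
    where
      p^k∣mq : p ℕ.^ k ℕᵈ.∣ m ℕ.* q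
      p^k∣mq = ℕᵈ.*-cancelʳ-∣ p
        (subst₂ ℕᵈ._∣_ (ℕP.*-comm p (p ℕ.^ k)) (sym (ℕP.*-assoc m q p)) p^[1+k]∣mn)

  p∣n*n⇒p∣n : ∀ {n} → p ℕᵈ.∣ n ℕ.* n → p ℕᵈ.∣ n
  p∣n*n⇒p∣n {n} p∣n² = [ id , id ]′ (euclidsLemma n n p-prime p∣n²)

  p^[2k+1]∣n*n⇒p^[k+1]∣n : ∀ k {n} → p ℕ.^ (k ℕ.+ suc k) ℕᵈ.∣ n ℕ.* n → p ℕ.^ suc k ℕᵈ.∣ n
  p^[2k+1]∣n*n⇒p^[k+1]∣n zero {n} p∣n² =
    subst (ℕᵈ._∣ n) (sym (ℕP.*-identityʳ p))
      (p∣n*n⇒p∣n (subst (ℕᵈ._∣ n ℕ.* n) (ℕP.*-identityʳ p) p∣n²))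
  p^[2k+1]∣n*n⇒p^[k+1]∣n (suc k) {n} p^[2k+3]∣n²
    with p∣n*n⇒p∣n {n} (ℕᵈ.∣-trans (ℕᵈ.m∣m*n _) p^[2k+3]∣n²)
  ... | ℕᵈ.divides q refl = p^k∣q⇒p^[1+k]∣q*p (suc k) {q} (p^[2k+1]∣n*n⇒p^[k+1]∣n k {q} p^[2k+1]∣q²)
    where
      open ≡-Reasoning
      p^[2k+3]≡p²*p^[2k+1] : p ℕ.^ (suc k ℕ.+ suc (suc k)) ≡ (p ℕ.* p) ℕ.* p ℕ.^ (k ℕ.+ suc k)
      p^[2k+3]≡p²*p^[2k+1] = begin
        p ℕ.* p ℕ.^ (k ℕ.+ suc (suc k))  ≡⟨ cong (λ e → p ℕ.* p ℕ.^ e) (ℕP.+-suc k (suc k)) ⟩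
        p ℕ.* (p ℕ.* p ℕ.^ (k ℕ.+ suc k)) ≡⟨ sym (ℕP.*-assoc p p _) ⟩
        (p ℕ.* p) ℕ.* p ℕ.^ (k ℕ.+ suc k) ∎
      n²≡p²*q² : (q ℕ.* p) ℕ.* (q ℕ.* p) ≡ (p ℕ.* p) ℕ.* (q ℕ.* q)
      n²≡p²*q² = trans (ℕP.[m*n]*[o*p]≡[m*o]*[n*p] q p q p) (ℕP.*-comm (q ℕ.* q) (p ℕ.* p))
      p^[2k+1]∣q² : p ℕ.^ (k ℕ.+ suc k) ℕᵈ.∣ q ℕ.* q
      p^[2k+1]∣q² = ℕᵈ.*-cancelˡ-∣ (p ℕ.* p) {{ℕP.m*n≢0 p p}}
        (subst₂ ℕᵈ._∣_ p^[2k+3]≡p²*p^[2k+1] n²≡p²*q² p^[2k+3]∣n²)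

  p^k∣a*b⇒p^k∣b : ∀ k {a b} → ¬ + p ∣ˢ a → p^ k ∣ˢ a * b → p^ k ∣ˢ b
  p^k∣a*b⇒p^k∣b k {a} {b} p∤a p^k∣ab = ∣ᵤ⇒∣ (p^k∣m*n⇒p^k∣n k (p∤a ∘ ∣ᵤ⇒∣)
    (subst (p ℕ.^ k ℕᵈ.∣_) (ℤP.abs-* a b) (∣⇒∣ᵤ p^k∣ab)))

  p³∣s*s⇒p²∣s : ∀ {s} → p^ 3 ∣ˢ s * s → p^ 2 ∣ˢ s
  p³∣s*s⇒p²∣s {s} p³∣s² = ∣ᵤ⇒∣ (p^[2k+1]∣n*n⇒p^[k+1]∣n 1
    (subst (p ℕ.^ 3 ℕᵈ.∣_) (ℤP.abs-* s s) (∣⇒∣ᵤ p³∣s²)))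

  p∣a*b⇒p∣a⊎p∣b : ∀ {a b} → + p ∣ˢ a * b → + p ∣ˢ a ⊎ + p ∣ˢ b
  p∣a*b⇒p∣a⊎p∣b {a} {b} p∣ab = map ∣ᵤ⇒∣ ∣ᵤ⇒∣
    (euclidsLemma ∣ a ∣ ∣ b ∣ p-prime (subst (p ℕᵈ.∣_) (ℤP.abs-* a b) (∣⇒∣ᵤ p∣ab)))

  gcd[p,a]≡1⇒p∤a : ∀ {a} → gcd (+ p) a ≡ + 1 → ¬ + p ∣ˢ a
  gcd[p,a]≡1⇒p∤a gcd≡1 p∣a = nonTrivial⇒≢1 {{prime⇒nonTrivial p-prime}} (ℕᵈ.∣1⇒≡1
    (subst (p ℕᵈ.∣_) (ℤP.+-injective gcd≡1) (ℕG.gcd-greatest ℕᵈ.∣-refl (∣⇒∣ᵤ p∣a))))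

  p≢2∧p∤a⇒p∤4*a : p ≢ 2 → ∀ {a} → ¬ + p ∣ˢ a → ¬ + p ∣ˢ + 4 * a
  p≢2∧p∤a⇒p∤4*a p≢2 p∤a p∣4a with p∣a*b⇒p∣a⊎p∣b p∣4a
  ... | inj₂ p∣a = p∤a p∣a
  ... | inj₁ p∣4 =
    p≢2 (ℕP.≤-antisym (ℕᵈ.∣⇒≤ (∣⇒∣ᵤ p∣2)) (nonTrivial⇒n>1 p {{prime⇒nonTrivial p-prime}}))
    where
      p∣2 : + p ∣ˢ + 2
      p∣2 = [ id , id ]′ (p∣a*b⇒p∣a⊎p∣b {+ 2} {+ 2} p∣4)

module _ {m : ℕ} (a u : ℤ) (au≡1 : a * u ≡ + 1 [mod m ]) where

  private
    m∣au-1 : + m ∣ˢ a * u - + 1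
    m∣au-1 = ∣ᵤ⇒∣ au≡1

  m∣a*x+b⇔x≡-b*u : ∀ x b → + m ∣ˢ a * x + b ⇔ (x ≡ - b * u [mod m ])
  m∣a*x+b⇔x≡-b*u x b = mk⇔
    (λ m∣ax+b → ∣⇒∣ᵤ (subst (+ m ∣ˢ_) (sym (x+bu≡u[ax+b]-x[au-1] a b u x))
      (∣m∣n⇒∣m-n (∣n⇒∣m*n u m∣ax+b) (∣n⇒∣m*n x m∣au-1))))
    (λ x≡-bu → subst (+ m ∣ˢ_) (sym (ax+b≡a[x+bu]-b[au-1] a b u x))
      (∣m∣n⇒∣m-n (∣n⇒∣m*n a (∣ᵤ⇒∣ x≡-bu)) (∣n⇒∣m*n b m∣au-1)))
    where
      x+bu≡u[ax+b]-x[au-1] : ∀ a b u x → x - - b * u ≡ u * (a * x + b) - x * (a * u - + 1)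
      x+bu≡u[ax+b]-x[au-1] = solve-∀
      ax+b≡a[x+bu]-b[au-1] : ∀ a b u x → a * x + b ≡ a * (x - - b * u) - b * (a * u - + 1)
      ax+b≡a[x+bu]-b[au-1] = solve-∀

  m∣a*x+b-q*[a*y]⇔x≡-b*u+q*y : ∀ x b q y → + m ∣ˢ a * x + b - q * (a * y) ⇔ (x ≡ - b * u + q * y [mod m ])
  m∣a*x+b-q*[a*y]⇔x≡-b*u+q*y x b q y = mk⇔
    (λ m∣ax+b-qay → ∣⇒∣ᵤ (subst (+ m ∣ˢ_) (sym (x-[-bu+qy]≡u[ax+b-qay]-[x-qy][au-1] a b q u x y))
      (∣m∣n⇒∣m-n (∣n⇒∣m*n u m∣ax+b-qay) (∣n⇒∣m*n (x - q * y) m∣au-1))))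
    (λ x≡-bu+qy → subst (+ m ∣ˢ_) (sym (ax+b-qay≡a[x-[-bu+qy]]-b[au-1] a b q u x y))
      (∣m∣n⇒∣m-n (∣n⇒∣m*n a (∣ᵤ⇒∣ x≡-bu+qy)) (∣n⇒∣m*n b m∣au-1)))
    where
      x-[-bu+qy]≡u[ax+b-qay]-[x-qy][au-1] : ∀ a b q u x y →
        x - (- b * u + q * y) ≡ u * (a * x + b - q * (a * y)) - (x - q * y) * (a * u - + 1)
      x-[-bu+qy]≡u[ax+b-qay]-[x-qy][au-1] = solve-∀
      ax+b-qay≡a[x-[-bu+qy]]-b[au-1] : ∀ a b q u x y →
        a * x + b - q * (a * y) ≡ a * (x - (- b * u + q * y)) - b * (a * u - + 1)
      ax+b-qay≡a[x-[-bu+qy]]-b[au-1] = solve-∀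

module Quadratic {p : ℕ} (p-prime : Prime p) (A B C : ℤ) (p∤4A : ¬ + p ∣ˢ + 4 * A) (r : ℤ) where

  open Powers p
  open PrimePowers p-prime

  s : ℤ
  s = (+ 2 * A) * r + B

  D : ℤ
  D = disc A B C

  4A*f[r]≡s²-D : + 4 * A * quadf A B C r ≡ s * s - D
  4A*f[r]≡s²-D = 4Af≡[2Ar+B]²-[B²-4AC] A B C r
    where
      4Af≡[2Ar+B]²-[B²-4AC] : ∀ A B C r →
        + 4 * A * (A * r * r + B * r + C) ≡ ((+ 2 * A) * r + B) * ((+ 2 * A) * r + B) - (B * B - + 4 * A * C)
      4Af≡[2Ar+B]²-[B²-4AC] = solve-∀

  2Ar≡-B⇔p^k∣s : ∀ k → (+ 2 * A) * r ≡ - B [mod p ℕ.^ k ] ⇔ p^ k ∣ˢ s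
  2Ar≡-B⇔p^k∣s k =
    mk⇔ (subst (p^ k ∣ˢ_) 2Ar--B≡s ∘ ∣ᵤ⇒∣) (∣⇒∣ᵤ ∘ subst (p^ k ∣ˢ_) (sym 2Ar--B≡s))
    where
      2Ar--B≡s : (+ 2 * A) * r - - B ≡ s
      2Ar--B≡s = cong (λ b → (+ 2 * A) * r + b) (ℤP.neg-involutive B)

  f[r]≡0⇔p^k∣s²-D : ∀ k → quadf A B C r ≡ + 0 [mod p ℕ.^ k ] ⇔ p^ k ∣ˢ s * s - D
  f[r]≡0⇔p^k∣s²-D k = mk⇔
    (λ f≡0 → subst (p^ k ∣ˢ_) 4A*f[r]≡s²-D
      (∣n⇒∣m*n (+ 4 * A) (subst (p^ k ∣ˢ_) f-0≡f (∣ᵤ⇒∣ f≡0))))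
    (λ p^k∣s²-D → ∣⇒∣ᵤ (subst (p^ k ∣ˢ_) (sym f-0≡f)
      (p^k∣a*b⇒p^k∣b k p∤4A (subst (p^ k ∣ˢ_) (sym 4A*f[r]≡s²-D) p^k∣s²-D))))
    where
      f-0≡f : quadf A B C r - + 0 ≡ quadf A B C r
      f-0≡f = ℤP.+-identityʳ (quadf A B C r)

  R⇔p^k∣s∧p^[k+2]∣s²-D : ∀ k → R p A B C r k ⇔ (p^ k ∣ˢ s × p^ (k ℕ.+ 2) ∣ˢ s * s - D)
  R⇔p^k∣s∧p^[k+2]∣s²-D k = 2Ar≡-B⇔p^k∣s k ×-⇔ f[r]≡0⇔p^k∣s²-D (k ℕ.+ 2)

  R[1]⇒p∣D : R p A B C r 1 → + p ∣ˢ D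
  R[1]⇒p∣D R₁ with to (R⇔p^k∣s∧p^[k+2]∣s²-D 1) R₁
  ... | p∣s , p³∣s²-D = p^1∣a⇒p∣a (∣m∣m-n⇒∣n (∣m⇒∣m*n s p∣s) (p^[m+n]∣a⇒p^m∣a 1 2 p³∣s²-D))

  R[2]⇒p⁴∣D : R p A B C r 2 → p^ 4 ∣ˢ D
  R[2]⇒p⁴∣D R₂ with to (R⇔p^k∣s∧p^[k+2]∣s²-D 2) R₂
  ... | p²∣s , p⁴∣s²-D = ∣m∣m-n⇒∣n (p^m∣a∧p^n∣b⇒p^[m+n]∣a*b 2 2 p²∣s p²∣s) p⁴∣s²-D

  p³∣D⇒R[1]⇔p²∣s : p^ 3 ∣ˢ D → R p A B C r 1 ⇔ p^ 2 ∣ˢ s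
  p³∣D⇒R[1]⇔p²∣s p³∣D = mk⇔
    (λ R₁ → p³∣s*s⇒p²∣s (∣m-n∣n⇒∣m (proj₂ (to (R⇔p^k∣s∧p^[k+2]∣s²-D 1) R₁)) p³∣D))
    (λ p²∣s → from (R⇔p^k∣s∧p^[k+2]∣s²-D 1)
      ( p^[m+n]∣a⇒p^m∣a 1 1 p²∣s
      , ∣m∣n⇒∣m-n (p^[m+n]∣a⇒p^m∣a 3 1 (p^m∣a∧p^n∣b⇒p^[m+n]∣a*b 2 2 p²∣s p²∣s)) p³∣D))

  p⁴∣D⇒R[2]⇔p²∣s : p^ 4 ∣ˢ D → R p A B C r 2 ⇔ p^ 2 ∣ˢ s
  p⁴∣D⇒R[2]⇔p²∣s p⁴∣D = mk⇔
    (proj₁ ∘ to (R⇔p^k∣s∧p^[k+2]∣s²-D 2))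
    (λ p²∣s → from (R⇔p^k∣s∧p^[k+2]∣s²-D 2)
      (p²∣s , ∣m∣n⇒∣m-n (p^m∣a∧p^n∣b⇒p^[m+n]∣a*b 2 2 p²∣s p²∣s) p⁴∣D))

  module _ {D' : ℤ} (D≡p²D' : D ≡ p^ 2 * D') where

    R[1]⇔∃w : R p A B C r 1 ⇔ (∃[ w ] (p^ 2 ∣ˢ s - + p * w × + p ∣ˢ w * w - D'))
    R[1]⇔∃w = mk⇔
      (λ R₁ → let p∣s , p³∣s²-D = to (R⇔p^k∣s∧p^[k+2]∣s²-D 1) R₁ in
        p∣s∧p³∣s²-p²d⇒∃w (p^1∣a⇒p∣a p∣s) (subst (λ d → p^ 3 ∣ˢ s * s - d) D≡p²D' p³∣s²-D))
      (λ (w , p²∣s-pw , p∣w²-D') → from (R⇔p^k∣s∧p^[k+2]∣s²-D 1)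
        ( p∣a⇒p^1∣a (p²∣s-pw⇒p∣s {s} {w} p²∣s-pw)
        , subst (λ d → p^ 3 ∣ˢ s * s - d) (sym D≡p²D')
            (p²∣s-pw∧p∣w²-d⇒p³∣s²-p²d {s} {D'} {w} p²∣s-pw p∣w²-D')))

    ∃w⇔∃y : ∀ {u} → (+ 2 * A) * u ≡ + 1 [mod p ℕ.^ 2 ] →
      (∃[ w ] (p^ 2 ∣ˢ s - + p * w × + p ∣ˢ w * w - D'))
        ⇔ (∃[ y ] ((r ≡ - B * u + + p * y [mod p ℕ.^ 2 ]) × ((+ 2 * A * y) * (+ 2 * A * y) ≡ D' [mod p ])))
    ∃w⇔∃y {u} 2Au≡1 = mk⇔ w↦uw 2Ay↤y
      where
        p²∣2Au-1 : p^ 2 ∣ˢ (+ 2 * A) * u - + 1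
        p²∣2Au-1 = ∣ᵤ⇒∣ 2Au≡1

        p∣2Au-1 : + p ∣ˢ (+ 2 * A) * u - + 1
        p∣2Au-1 = p^1∣a⇒p∣a (p^[m+n]∣a⇒p^m∣a 1 1 p²∣2Au-1)

        w↦uw : ∃[ w ] (p^ 2 ∣ˢ s - + p * w × + p ∣ˢ w * w - D') →
          ∃[ y ] ((r ≡ - B * u + + p * y [mod p ℕ.^ 2 ]) × ((+ 2 * A * y) * (+ 2 * A * y) ≡ D' [mod p ]))
        w↦uw (w , p²∣s-pw , p∣w²-D') = u * w
          , to (m∣a*x+b-q*[a*y]⇔x≡-b*u+q*y (+ 2 * A) u 2Au≡1 r B (+ p) (u * w)) p²∣s-p[2A[uw]]
          , ∣⇒∣ᵤ p∣[2A[uw]]²-D'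
          where
            s-q[a[uw]]≡s-qw-qw[au-1] : ∀ s a u w q →
              s - q * (a * (u * w)) ≡ (s - q * w) - (q * w) * (a * u - + 1)
            s-q[a[uw]]≡s-qw-qw[au-1] = solve-∀
            p²∣s-p[2A[uw]] : p^ 2 ∣ˢ s - + p * (+ 2 * A * (u * w))
            p²∣s-p[2A[uw]] = subst (p^ 2 ∣ˢ_) (sym (s-q[a[uw]]≡s-qw-qw[au-1] s (+ 2 * A) u w (+ p)))
              (∣m∣n⇒∣m-n p²∣s-pw (∣n⇒∣m*n (+ p * w) p²∣2Au-1))
            [a[uw]]²-d≡w²-d+w²[au-1][au+1] : ∀ a u w d →
              (a * (u * w)) * (a * (u * w)) - d ≡ (w * w - d) + (w * w) * ((a * u - + 1) * (a * u + + 1))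
            [a[uw]]²-d≡w²-d+w²[au-1][au+1] = solve-∀
            p∣[2A[uw]]²-D' : + p ∣ˢ (+ 2 * A * (u * w)) * (+ 2 * A * (u * w)) - D'
            p∣[2A[uw]]²-D' = subst (+ p ∣ˢ_) (sym ([a[uw]]²-d≡w²-d+w²[au-1][au+1] (+ 2 * A) u w D'))
              (∣m∣n⇒∣m+n p∣w²-D' (∣n⇒∣m*n (w * w) (∣m⇒∣m*n _ p∣2Au-1)))

        2Ay↤y : ∃[ y ] ((r ≡ - B * u + + p * y [mod p ℕ.^ 2 ]) × ((+ 2 * A * y) * (+ 2 * A * y) ≡ D' [mod p ])) →
          ∃[ w ] (p^ 2 ∣ˢ s - + p * w × + p ∣ˢ w * w - D')
        2Ay↤y (y , r≡-Bu+py , [2Ay]²≡D') = + 2 * A * y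
          , from (m∣a*x+b-q*[a*y]⇔x≡-b*u+q*y (+ 2 * A) u 2Au≡1 r B (+ p) y) r≡-Bu+py
          , ∣ᵤ⇒∣ [2Ay]²≡D'

lemma5p4 : (p : ℕ) → Prime p → ¬ (p ≡ 2) →
  (A B C : ℤ) → gcd A (+ p) ≡ + 1 →
  (r : ℤ) → quadf A B C r ≡ + 0 [mod p ℕ.^ 2 ] →
  -- (i)
  (gcd (+ p) (disc A B C) ≡ + 1 → ¬ R p A B C r 1)
  -- (ii)  here D' = D p^(-2) and u = (2A)^(-1) mod p^2
  × (p ^ 2 ∥ disc A B C →
      ((D' u : ℤ) → disc A B C ≡ + (p ℕ.^ 2) * D' → (+ 2 * A) * u ≡ + 1 [mod p ℕ.^ 2 ] →
        (R p A B C r 1 ⇔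
          (∃[ y ] ((r ≡ - B * u + + p * y [mod p ℕ.^ 2 ])
                   × ((+ 2 * A * y) * (+ 2 * A * y) ≡ D' [mod p ])))))
      × ¬ R p A B C r 2)
  -- (iii)
  × (p ^ 3 ∥ disc A B C →
      ((u : ℤ) → (+ 2 * A) * u ≡ + 1 [mod p ℕ.^ 2 ] →
        (R p A B C r 1 ⇔ (r ≡ - B * u [mod p ℕ.^ 2 ])))
      × ¬ R p A B C r 2)
  -- (iv)
  × (+ (p ℕ.^ 4) ∣ disc A B C →
      (u : ℤ) → (+ 2 * A) * u ≡ + 1 [mod p ℕ.^ 2 ] →
        (R p A B C r 1 ⇔ (r ≡ - B * u [mod p ℕ.^ 2 ]))
        × (R p A B C r 2 ⇔ (r ≡ - B * u [mod p ℕ.^ 2 ])))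
lemma5p4 p p-prime p≢2 A B C gcd[A,p]≡1 r _ =
    (λ gcd[p,D]≡1 → gcd[p,a]≡1⇒p∤a gcd[p,D]≡1 ∘ R[1]⇒p∣D)
  , (λ (_ , p³∤D) →
        (λ D' u D≡p²D' 2Au≡1 → ⇔-trans (R[1]⇔∃w D≡p²D') (∃w⇔∃y D≡p²D' 2Au≡1))
      , p³∤D ∘ ∣⇒∣ᵤ ∘ p^[m+n]∣a⇒p^m∣a 3 1 ∘ R[2]⇒p⁴∣D)
  , (λ (p³∣D , p⁴∤D) →
        (λ u 2Au≡1 → ⇔-trans (p³∣D⇒R[1]⇔p²∣s (∣ᵤ⇒∣ p³∣D)) (p²∣s⇔r≡-Bu u 2Au≡1))
      , p⁴∤D ∘ ∣⇒∣ᵤ ∘ R[2]⇒p⁴∣D)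
  , λ p⁴∣D u 2Au≡1 →
        ⇔-trans (p³∣D⇒R[1]⇔p²∣s (p^[m+n]∣a⇒p^m∣a 3 1 (∣ᵤ⇒∣ p⁴∣D))) (p²∣s⇔r≡-Bu u 2Au≡1)
      , ⇔-trans (p⁴∣D⇒R[2]⇔p²∣s (∣ᵤ⇒∣ p⁴∣D)) (p²∣s⇔r≡-Bu u 2Au≡1)
  where
    open Powers p
    open PrimePowers p-prime
    p∤4A : ¬ + p ∣ˢ + 4 * A
    p∤4A = p≢2∧p∤a⇒p∤4*a p≢2 (gcd[p,a]≡1⇒p∤a (trans (gcd-comm (+ p) A) gcd[A,p]≡1))

    open Quadratic p-prime A B C p∤4A r

    p²∣s⇔r≡-Bu : ∀ u → (+ 2 * A) * u ≡ + 1 [mod p ℕ.^ 2 ] → p^ 2 ∣ˢ s ⇔ (r ≡ - B * u [mod p ℕ.^ 2 ])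
    p²∣s⇔r≡-Bu u 2Au≡1 = m∣a*x+b⇔x≡-b*u (+ 2 * A) u 2Au≡1 r B
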